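{- Let $\mathcal{R},\mathcal{S}$ be TRSs over $\mathcal{F}$ such that $\mathcal{R}\cup\mathcal{S}$ is left-linear, and let $c\in\mathbb{N}$. If $u\to_{\mathcal{R}}v$ (resp. $u\to_{\mathcal{S}}v$), then for every term $u'$ over $\mathcal{F}_{\mathbb{N}}$ with $\mathrm{base}(u')=u$ there exists a term $v'$ with $\mathrm{base}(v')=v$ and $u'\to_{\mathrm{match}(\mathcal{R})}v'$ (resp. $u'\to_{\mathrm{MATCHRT}^c(\mathcal{S})}v'$).
   Context: Left-linear: no variable occurs twice in a left-hand side. For $N\subseteq\mathbb{N}$, $\mathcal{F}_N$ is the signature of symbols $f_c$ ($f\in\mathcal{F},c\in N$) with the arity of $f$; $\mathrm{lift}_c(f)=f_c$, $\mathrm{base}(f_c)=f$, $\mathrm{height}(f_c)=c$, extended to terms (variables fixed) and TRSs. $\mathrm{FPos}(t)$: positions of function symbols in $t$; $\|t\|$: number of function symbol occurrences. $\mathrm{match}(\mathcal{R})$: all rules $l'\to\mathrm{lift}_d(r)$ with $l\to r\in\mathcal{R}$, $\mathrm{base}(l')=l$, $d=1+\min\{\mathrm{height}(l'(p))\mid p\in\mathrm{FPos}(l)\}$. $\mathrm{MATCHRT}^c(\mathcal{S})$: all rules $l'\to\mathrm{lift}_d(r)$ with $\mathrm{base}(l')\to r\in\mathcal{S}$, where $d=\min\{c,\mathrm{height}(l'(\epsilon))\}$ if $\|\mathrm{base}(l')\|\ge\|r\|$ and $\mathrm{lift}_{\mathrm{height}(l'(\epsilon))}(\mathrm{base}(l'))=l'$,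 and $d=\min(\{c\}\cup\{1+\mathrm{height}(l'(p))\mid p\in\mathrm{FPos}(l')\})$ otherwise. -}

module Defs where

open import Data.Nat using (ℕ; zero; suc; _+_; _⊓_; _≥_)
open import Data.Fin using (Fin)
open import Data.Vec using (Vec; []; _∷_; lookup; _[_]≔_)
open import Data.List using (List; []; _∷_; _++_; foldr; map)
open import Data.List.Relation.Unary.Unique.Propositional using (Unique)
open import Data.Product using (_×_; _,_; proj₁; proj₂)
open import Data.Sum using (_⊎_)
open import Relation.Binary.PropositionalEquality using (_≡_)
open import Relation.Nullary using (¬_)

record Sig : Set₁ where
  field
    Sym   : Set
    arity : Sym → ℕ
open Sig public

data Term (Σ : Sig) : Set where
  var : ℕ → Term Σ
  fun : (f : Sym Σ) → Vec (Term Σ) (arity Σ f) → Term Σ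

module _ {Σ : Sig} where
  mutual
    _⟨_⟩ : Term Σ → (ℕ → Term Σ) → Term Σ
    var x    ⟨ σ ⟩ = σ x
    fun f ts ⟨ σ ⟩ = fun f (ts ⟨ σ ⟩*)

    _⟨_⟩* : ∀ {n} → Vec (Term Σ) n → (ℕ → Term Σ) → Vec (Term Σ) n
    []       ⟨ σ ⟩* = []
    (t ∷ ts) ⟨ σ ⟩* = (t ⟨ σ ⟩) ∷ (ts ⟨ σ ⟩*)

  mutual
    vars : Term Σ → List ℕ
    vars (var x)    = x ∷ []
    vars (fun f ts) = vars* ts

    vars* : ∀ {n} → Vec (Term Σ) n → List ℕ
    vars* []       = []
    vars* (t ∷ ts) = vars t ++ vars* ts

  mutual
    size : Term Σ → ℕ
    size (var x)    = 0
    size (fun f ts) = suc (size* ts)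

    size* : ∀ {n} → Vec (Term Σ) n → ℕ
    size* []       = 0
    size* (t ∷ ts) = size t + size* ts

  -- rewrite rules and TRSs (possibly infinite sets of rules, given as predicates)
  Rule : Set
  Rule = Term Σ × Term Σ

  TRS : Set₁
  TRS = Rule → Set

  _∪_ : TRS → TRS → TRS
  (R ∪ S) ρ = R ρ ⊎ S ρ

  IsVar : Term Σ → Set
  IsVar t = Data.Product.Σ ℕ (λ x → t ≡ var x)

  _∈ᵥ_ : ℕ → Term Σ → Set
  x ∈ᵥ t = Data.List.Membership.Propositional._∈_ x (vars t)
    where import Data.List.Membership.Propositional

  IsTRS : TRS → Set
  IsTRS R = ∀ {l r} → R (l , r) → ¬ IsVar l × (∀ x → x ∈ᵥ r → x ∈ᵥ l)

  Linear : Term Σ → Set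
  Linear t = Unique (vars t)

  LeftLinear : TRS → Set
  LeftLinear R = ∀ {l r} → R (l , r) → Linear l

  data _⟶[_]_ : Term Σ → TRS → Term Σ → Set₁ where
    root : ∀ {R l r} → R (l , r) → (σ : ℕ → Term Σ) → (l ⟨ σ ⟩) ⟶[ R ] (r ⟨ σ ⟩)
    ctx  : ∀ {R} (f : Sym Σ) (ts : Vec (Term Σ) (arity Σ f)) (i : Fin (arity Σ f)) {t′} →
           lookup ts i ⟶[ R ] t′ → fun f ts ⟶[ R ] fun f (ts [ i ]≔ t′)

_ₙ : Sig → Sig
Σ ₙ = record { Sym = Sym Σ × ℕ ; arity = λ fc → arity Σ (proj₁ fc) }

module _ {Σ : Sig} where
  mutual
    lift : ℕ → Term Σ → Term (Σ ₙ)
    lift c (var x)    = var x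
    lift c (fun f ts) = fun (f , c) (lift* c ts)

    lift* : ∀ {n} → ℕ → Vec (Term Σ) n → Vec (Term (Σ ₙ)) n
    lift* c []       = []
    lift* c (t ∷ ts) = lift c t ∷ lift* c ts

  mutual
    base : Term (Σ ₙ) → Term Σ
    base (var x)          = var x
    base (fun (f , c) ts) = fun f (base* ts)

    base* : ∀ {n} → Vec (Term (Σ ₙ)) n → Vec (Term Σ) n
    base* []       = []
    base* (t ∷ ts) = base t ∷ base* ts

  mutual
    heights : Term (Σ ₙ) → List ℕ
    heights (var x)          = []
    heights (fun (f , c) ts) = c ∷ heights* ts

    heights* : ∀ {n} → Vec (Term (Σ ₙ)) n → List ℕ
    heights* []       = []
    heights* (t ∷ ts) = heights t ++ heights* ts

  -- height(t(ε)); only used for non-variable t (value 0 for variables is irrelevant)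
  rootHeight : Term (Σ ₙ) → ℕ
  rootHeight (var x)          = 0
  rootHeight (fun (f , c) ts) = c

  -- min { height(t(p)) | p ∈ FPos(t) }; only used for non-variable t
  -- (FPos nonempty); the value 0 for variables is irrelevant
  minHeight : Term (Σ ₙ) → ℕ
  minHeight (var x)          = 0
  minHeight (fun (f , c) ts) = foldr _⊓_ c (heights* ts)

  data match (R : TRS {Σ}) : TRS {Σ ₙ} where
    mk : ∀ {l′ r} → R (base l′ , r) →
         match R (l′ , lift (suc (minHeight l′)) r)

  data MATCHRT (c : ℕ) (S : TRS {Σ}) : TRS {Σ ₙ} where
    mk₁ : ∀ {l′ r} → S (base l′ , r) →
          size (base l′) ≥ size r → lift (rootHeight l′) (base l′) ≡ l′ →
          MATCHRT c S (l′ , lift (c ⊓ rootHeight l′) r)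
    mk₂ : ∀ {l′ r} → S (base l′ , r) →
          ¬ (size (base l′) ≥ size r × lift (rootHeight l′) (base l′) ≡ l′) →
          MATCHRT c S (l′ , lift (foldr _⊓_ c (map suc (heights l′))) r)

-- Both halves are instances of one simulation lemma.  Say that a TRS R′ over
-- F_ℕ covers R when, for every rule l → r of R and every lifting l′ of l
-- (base l′ ≡ l), R′ contains a rule l′ → lift_d r for some height d.  If R is
-- left-linear and R′ covers R, then every step u →_R v can be replayed from any
-- lifting u′ of u as a step u′ →_R′ v′ with base v′ ≡ v.
--
-- The heart of the simulation is the lifted-matching lemma: if l is linear and
-- base u′ ≡ lσ, then u′ ≡ l′σ′ for a lifting l′ of l and a substitution σ′
-- lifting σ.  Linearity is what allows the substitutions found for the
-- arguments of l to be merged into one.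
module Submission where

open import Defs
open import Data.Nat using (ℕ; _≤?_; _≟_)
open import Data.Product using (_×_; _,_; ∃)
open import Data.Sum using (inj₁; inj₂)
open import Data.Fin using () renaming (zero to fzero; suc to fsuc)
open import Data.Vec using (Vec; []; _∷_; lookup; _[_]≔_)
open import Data.Vec.Properties using (∷-injectiveˡ; ∷-injectiveʳ)
open import Data.List using (List; []; _∷_; _++_)
open import Data.List.Relation.Unary.All as All using (All; []; _∷_; all?)
open import Data.List.Relation.Unary.All.Properties using (++⁺; ++⁻ˡ; ++⁻ʳ)
open import Data.List.Relation.Unary.Any using (here; there)
open import Data.List.Relation.Unary.Unique.Propositional using (Unique; []; _∷_)
open import Data.List.Relation.Binary.Disjoint.Propositional using (Disjoint)
open import Data.List.Membership.Propositional using (_∈_; _∉_)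
open import Data.List.Membership.Propositional.Properties using (∈-++⁺ˡ; ∈-++⁺ʳ)
open import Data.List.Membership.DecPropositional _≟_ using (_∈?_)
open import Relation.Nullary using (Dec; yes; no; contradiction)
open import Relation.Nullary.Decidable using (_×-dec_)
open import Relation.Binary.PropositionalEquality
  using (_≡_; refl; sym; trans; cong; cong₂; subst; module ≡-Reasoning)

Unique-++⁻ : ∀ (xs : List ℕ) {ys} → Unique (xs ++ ys) →
             Unique xs × Unique ys × Disjoint xs ys
Unique-++⁻ []       u           = [] , u , λ ()
Unique-++⁻ (x ∷ xs) (x∉ ∷ u) with Unique-++⁻ xs u
... | uxs , uys , disjoint = ++⁻ˡ xs x∉ ∷ uxs , uys , λ where
  (here refl , x∈ys) → All.lookup (++⁻ʳ xs x∉) x∈ys refl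
  (there v∈xs , v∈ys) → disjoint (v∈xs , v∈ys)

module _ {A : Set} where
  _◁[_]_ : (ℕ → A) → List ℕ → (ℕ → A) → ℕ → A
  (σ₁ ◁[ xs ] σ₂) y with y ∈? xs
  ... | yes _ = σ₁ y
  ... | no  _ = σ₂ y

  ◁-inside : ∀ σ₁ xs σ₂ {y} → y ∈ xs → (σ₁ ◁[ xs ] σ₂) y ≡ σ₁ y
  ◁-inside σ₁ xs σ₂ {y} y∈xs with y ∈? xs
  ... | yes _   = refl
  ... | no  y∉xs = contradiction y∈xs y∉xs

  ◁-outside : ∀ σ₁ xs σ₂ {y} → y ∉ xs → (σ₁ ◁[ xs ] σ₂) y ≡ σ₂ y
  ◁-outside σ₁ xs σ₂ {y} y∉xs with y ∈? xs
  ... | yes y∈xs = contradiction y∈xs y∉xs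
  ... | no  _    = refl

  ◁-pointwise : ∀ (P : ℕ → A → Set) σ₁ xs σ₂ →
                (∀ y → y ∈ xs → P y (σ₁ y)) → (∀ y → y ∉ xs → P y (σ₂ y)) →
                ∀ y → P y ((σ₁ ◁[ xs ] σ₂) y)
  ◁-pointwise P σ₁ xs σ₂ in₁ out₂ y with y ∈? xs
  ... | yes y∈xs = in₁ y y∈xs
  ... | no  y∉xs = out₂ y y∉xs

module _ {Σ : Sig} where
  mutual
    subst-cong : (t : Term Σ) {σ τ : ℕ → Term Σ} →
                 (∀ x → x ∈ vars t → σ x ≡ τ x) → t ⟨ σ ⟩ ≡ t ⟨ τ ⟩
    subst-cong (var x)    σ≡τ = σ≡τ x (here refl)
    subst-cong (fun f ts) σ≡τ = cong (fun f) (subst-cong* ts σ≡τ)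

    subst-cong* : ∀ {n} (ts : Vec (Term Σ) n) {σ τ : ℕ → Term Σ} →
                  (∀ x → x ∈ vars* ts → σ x ≡ τ x) → ts ⟨ σ ⟩* ≡ ts ⟨ τ ⟩*
    subst-cong* []       σ≡τ = refl
    subst-cong* (t ∷ ts) σ≡τ =
      cong₂ _∷_ (subst-cong t (λ x x∈ → σ≡τ x (∈-++⁺ˡ x∈)))
                (subst-cong* ts (λ x x∈ → σ≡τ x (∈-++⁺ʳ (vars t) x∈)))

module _ {Σ : Sig} where
  mutual
    base-lift : ∀ c (t : Term Σ) → base (lift c t) ≡ t
    base-lift c (var x)    = refl
    base-lift c (fun f ts) = cong (fun f) (base-lift* c ts)

    base-lift* : ∀ {n} c (ts : Vec (Term Σ) n) → base* (lift* c ts) ≡ ts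
    base-lift* c []       = refl
    base-lift* c (t ∷ ts) = cong₂ _∷_ (base-lift c t) (base-lift* c ts)

  mutual
    vars-base : (t : Term (Σ ₙ)) → vars (base t) ≡ vars t
    vars-base (var x)          = refl
    vars-base (fun (f , c) ts) = vars-base* ts

    vars-base* : ∀ {n} (ts : Vec (Term (Σ ₙ)) n) → vars* (base* ts) ≡ vars* ts
    vars-base* []       = refl
    vars-base* (t ∷ ts) = cong₂ _++_ (vars-base t) (vars-base* ts)

  mutual
    base-subst : (t : Term (Σ ₙ)) (σ : ℕ → Term (Σ ₙ)) →
                 base (t ⟨ σ ⟩) ≡ base t ⟨ (λ x → base (σ x)) ⟩
    base-subst (var x)          σ = refl
    base-subst (fun (f , c) ts) σ = cong (fun f) (base-subst* ts σ)

    base-subst* : ∀ {n} (ts : Vec (Term (Σ ₙ)) n) (σ : ℕ → Term (Σ ₙ)) →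
                  base* (ts ⟨ σ ⟩*) ≡ base* ts ⟨ (λ x → base (σ x)) ⟩*
    base-subst* []       σ = refl
    base-subst* (t ∷ ts) σ = cong₂ _∷_ (base-subst t σ) (base-subst* ts σ)

  base-lookup : ∀ {n} (us : Vec (Term (Σ ₙ)) n) i → lookup (base* us) i ≡ base (lookup us i)
  base-lookup (u ∷ us) fzero    = refl
  base-lookup (u ∷ us) (fsuc i) = base-lookup us i

  base-update : ∀ {n} (us : Vec (Term (Σ ₙ)) n) i v →
                base* (us [ i ]≔ v) ≡ base* us [ i ]≔ base v
  base-update (u ∷ us) fzero    v = refl
  base-update (u ∷ us) (fsuc i) v = cong (base u ∷_) (base-update us i v)

  base-fun⁻ : ∀ {f} {ts : Vec (Term Σ) (arity Σ f)} (u′ : Term (Σ ₙ)) → base u′ ≡ fun f ts →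
              ∃ λ c → ∃ λ us′ → u′ ≡ fun (f , c) us′ × base* us′ ≡ ts
  base-fun⁻ (fun (f , c) us′) refl = c , us′ , refl , refl

  record LiftedMatch (l : Term Σ) (σ : ℕ → Term Σ) (u′ : Term (Σ ₙ)) : Set where
    constructor lifted-match
    field
      l′      : Term (Σ ₙ)
      σ′      : ℕ → Term (Σ ₙ)
      base-l′ : base l′ ≡ l
      l′σ′≡u′ : l′ ⟨ σ′ ⟩ ≡ u′
      base-σ′ : ∀ x → base (σ′ x) ≡ σ x

  record LiftedMatch* {n} (ls : Vec (Term Σ) n) (σ : ℕ → Term Σ)
                      (us′ : Vec (Term (Σ ₙ)) n) : Set where
    constructor lifted-match*
    field
      ls′      : Vec (Term (Σ ₙ)) n
      σ′       : ℕ → Term (Σ ₙ)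
      base-ls′ : base* ls′ ≡ ls
      ls′σ′≡us′ : ls′ ⟨ σ′ ⟩* ≡ us′
      base-σ′  : ∀ x → base (σ′ x) ≡ σ x

  -- A variable x is matched by sending x to u′;
  -- for f(l₁,…,lₙ) the matchers of the arguments are merged, which is
  -- consistent because the lᵢ share no variables.
  mutual
    lifted-match-linear : (l : Term Σ) → Linear l → (σ : ℕ → Term Σ) (u′ : Term (Σ ₙ)) →
                          base u′ ≡ l ⟨ σ ⟩ → LiftedMatch l σ u′
    lifted-match-linear (var x) _ σ u′ base-u′ =
      lifted-match (var x) σ′ refl (◁-inside (λ _ → u′) (x ∷ []) σ₀ (here refl))
        (◁-pointwise (λ y t → base t ≡ σ y) (λ _ → u′) (x ∷ []) σ₀
          (λ { _ (here refl) → base-u′ }) (λ y _ → base-lift 0 (σ y)))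
      where
      σ₀ : ℕ → Term (Σ ₙ)
      σ₀ y = lift 0 (σ y)
      σ′ : ℕ → Term (Σ ₙ)
      σ′ = (λ _ → u′) ◁[ x ∷ [] ] σ₀
    lifted-match-linear (fun f ls) lin σ u′ base-u′ with base-fun⁻ u′ base-u′
    ... | c , us′ , refl , base-us′ with lifted-match-linear* ls lin σ us′ base-us′
    ... | lifted-match* ls′ σ′ base-ls′ ls′σ′≡us′ base-σ′ =
      lifted-match (fun (f , c) ls′) σ′ (cong (fun f) base-ls′)
                   (cong (fun (f , c)) ls′σ′≡us′) base-σ′

    lifted-match-linear* : ∀ {n} (ls : Vec (Term Σ) n) → Unique (vars* ls) →
                           (σ : ℕ → Term Σ) (us′ : Vec (Term (Σ ₙ)) n) →
                           base* us′ ≡ ls ⟨ σ ⟩* → LiftedMatch* ls σ us′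
    lifted-match-linear* [] _ σ [] _ =
      lifted-match* [] (λ y → lift 0 (σ y)) refl refl (λ y → base-lift 0 (σ y))
    lifted-match-linear* (l ∷ ls) lin σ (u′ ∷ us′) base-us′
      with Unique-++⁻ (vars l) lin
    ... | lin-l , lin-ls , disjoint
      with lifted-match-linear l lin-l σ u′ (∷-injectiveˡ base-us′)
         | lifted-match-linear* ls lin-ls σ us′ (∷-injectiveʳ base-us′)
    ... | lifted-match l′ σ₁ base-l′ l′σ₁≡u′ base-σ₁
        | lifted-match* ls′ σ₂ base-ls′ ls′σ₂≡us′ base-σ₂ =
      lifted-match* (l′ ∷ ls′) σ′ (cong₂ _∷_ base-l′ base-ls′)
        (cong₂ _∷_ (trans (subst-cong l′ on-l′) l′σ₁≡u′)
                   (trans (subst-cong* ls′ on-ls′) ls′σ₂≡us′))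
        (◁-pointwise (λ y t → base t ≡ σ y) σ₁ (vars l) σ₂
          (λ y _ → base-σ₁ y) (λ y _ → base-σ₂ y))
      where
      σ′ : ℕ → Term (Σ ₙ)
      σ′ = σ₁ ◁[ vars l ] σ₂
      on-l′ : ∀ y → y ∈ vars l′ → σ′ y ≡ σ₁ y
      on-l′ y y∈ = ◁-inside σ₁ (vars l) σ₂
        (subst (y ∈_) (trans (sym (vars-base l′)) (cong vars base-l′)) y∈)
      on-ls′ : ∀ y → y ∈ vars* ls′ → σ′ y ≡ σ₂ y
      on-ls′ y y∈ = ◁-outside σ₁ (vars l) σ₂ λ y∈l →
        disjoint (y∈l , subst (y ∈_) (trans (sym (vars-base* ls′)) (cong vars* base-ls′)) y∈)

  Covers : TRS {Σ} → TRS {Σ ₙ} → Set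
  Covers R R′ = ∀ {l′ r} → R (base l′ , r) → ∃ λ d → R′ (l′ , lift d r)

  -- At the
  -- root, lifted matching yields l′σ′ ≡ u′ and we step to (lift_d r)σ′, whose
  -- base is rσ; below the root we recurse into the rewritten argument.
  simulate : (R : TRS {Σ}) (R′ : TRS {Σ ₙ}) → LeftLinear R → Covers R R′ →
             ∀ {u v} → u ⟶[ R ] v → (u′ : Term (Σ ₙ)) → base u′ ≡ u →
             ∃ λ v′ → base v′ ≡ v × u′ ⟶[ R′ ] v′
  simulate R R′ left-linear covers (root {l = l} {r = r} l→r σ) u′ base-u′
    with lifted-match-linear l (left-linear l→r) σ u′ base-u′
  ... | lifted-match l′ σ′ refl refl base-σ′ with covers {l′} {r} l→r
  ... | d , l′→r′ = lift d r ⟨ σ′ ⟩ , base-contractum , root l′→r′ σ′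
    where
    open ≡-Reasoning
    base-contractum : base (lift d r ⟨ σ′ ⟩) ≡ r ⟨ σ ⟩
    base-contractum = begin
      base (lift d r ⟨ σ′ ⟩)                   ≡⟨ base-subst (lift d r) σ′ ⟩
      base (lift d r) ⟨ (λ x → base (σ′ x)) ⟩  ≡⟨ cong (_⟨ (λ x → base (σ′ x)) ⟩) (base-lift d r) ⟩
      r ⟨ (λ x → base (σ′ x)) ⟩                ≡⟨ subst-cong r (λ x _ → base-σ′ x) ⟩
      r ⟨ σ ⟩                                  ∎
  simulate R R′ left-linear covers (ctx f ts i step) u′ base-u′
    with base-fun⁻ u′ base-u′
  ... | c , us′ , refl , refl
    with simulate R R′ left-linear covers step (lookup us′ i) (sym (base-lookup us′ i))
  ... | v′ , base-v′ , step′ =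
    fun (f , c) (us′ [ i ]≔ v′) ,
    cong (fun f) (trans (base-update us′ i v′) (cong (base* us′ [ i ]≔_) base-v′)) ,
    ctx (f , c) us′ i step′

  -- A lifted term equals lift_h of its base exactly when all its heights are
  -- h; hence the side condition lift_{height(l′(ε))}(base l′) = l′ of
  -- MATCHRT is decidable.
  mutual
    heights-lift : ∀ h (t : Term Σ) → All (_≡ h) (heights (lift h t))
    heights-lift h (var x)    = []
    heights-lift h (fun f ts) = refl ∷ heights-lift* h ts

    heights-lift* : ∀ {n} h (ts : Vec (Term Σ) n) → All (_≡ h) (heights* (lift* h ts))
    heights-lift* h []       = []
    heights-lift* h (t ∷ ts) = ++⁺ (heights-lift h t) (heights-lift* h ts)

  mutual
    lift-base-uniform : ∀ h (t : Term (Σ ₙ)) → All (_≡ h) (heights t) → lift h (base t) ≡ t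
    lift-base-uniform h (var x)          _            = refl
    lift-base-uniform h (fun (f , c) ts) (refl ∷ hs) = cong (fun (f , h)) (lift-base-uniform* h ts hs)

    lift-base-uniform* : ∀ {n} h (ts : Vec (Term (Σ ₙ)) n) → All (_≡ h) (heights* ts) →
                         lift* h (base* ts) ≡ ts
    lift-base-uniform* h []       _  = refl
    lift-base-uniform* h (t ∷ ts) hs =
      cong₂ _∷_ (lift-base-uniform h t (++⁻ˡ (heights t) hs))
                (lift-base-uniform* h ts (++⁻ʳ (heights t) hs))

  lift-base? : ∀ h (t : Term (Σ ₙ)) → Dec (lift h (base t) ≡ t)
  lift-base? h t with all? (_≟ h) (heights t)
  ... | yes uniform = yes (lift-base-uniform h t uniform)
  ... | no  ¬uniform = no λ eq →
    ¬uniform (subst (λ w → All (_≡ h) (heights w)) eq (heights-lift h (base t)))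

  match-covers : (R : TRS {Σ}) → Covers R (match R)
  match-covers R l→r = _ , mk l→r

  MATCHRT-covers : (c : ℕ) (S : TRS {Σ}) → Covers S (MATCHRT c S)
  MATCHRT-covers c S {l′} {r} l→r
    with (size r ≤? size (base l′)) ×-dec lift-base? (rootHeight l′) l′
  ... | yes (non-increasing , uniform) = _ , mk₁ l→r non-increasing uniform
  ... | no  ¬condition                 = _ , mk₂ l→r ¬condition

lemma5p5 : (Σ : Sig) (R S : TRS {Σ}) → IsTRS R → IsTRS S → LeftLinear (R ∪ S) → (c : ℕ) →
    (∀ {u v} → u ⟶[ R ] v → (u′ : Term (Σ ₙ)) → base u′ ≡ u →
      ∃ λ v′ → base v′ ≡ v × u′ ⟶[ match R ] v′)
    × (∀ {u v} → u ⟶[ S ] v → (u′ : Term (Σ ₙ)) → base u′ ≡ u →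
      ∃ λ v′ → base v′ ≡ v × u′ ⟶[ MATCHRT c S ] v′)
lemma5p5 Σ R S _ _ left-linear c =
  simulate R (match R) (λ l→r → left-linear (inj₁ l→r)) (match-covers R) ,
  simulate S (MATCHRT c S) (λ l→r → left-linear (inj₂ l→r)) (MATCHRT-covers c S)
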